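{- Let $A$, $B$, $P$ be strings with $m = |A|$, $n = |B|$, $r = |P| \geq 1$. For a string $S$, let $\mathrm{overlap}(S)$ denote the length of the longest prefix of $P$ that is a suffix of $S$. A string $Z$ satisfies $\mathsf{Property}(i,s,k)$ if $Z$ is a subsequence of $A[1..i]$, $Z$ does not contain $P$ as a substring, $|Z| = s$, and $\mathrm{overlap}(Z) = k$. For $0 \le i \le m$, $s \ge 0$, $0 \le k < r$, let $d(i,s,k)$ be the smallest $e \in \{0,\dots,n\}$ such that there exists a common subsequence of $A[1..i]$ and $B[1..e]$ satisfying $\mathsf{Property}(i,s,k)$, and $d(i,s,k) = n+1$ if no such $e$ exists. Then for all $1 \le i \le m$, $s \ge 1$ and $0 \le k < r$, $$d(i,s,k) = \min\big(\{d(i-1,s,k)\} \cup \{ j_t \mid 0 \le t < r\}\big),$$ where, for each $0 \le t < r$, $j_t$ is the smallest position $j$ with $d(i-1,s-1,t)+1 \le j \le n$ such that $A[i] = B[j]$ and there exists a string $Z$ satisfying $\mathsf{Property}(i-1,s-1,t)$ with $\mathrm{overlap}(Z A[i]) = k$; if no such $j$ (or no such $Z$) exists, then $j_t = n+1$.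
   Context: Strings are over an alphabet $\Sigma$; $w[i]$ is the $i$-th character of $w$ (1-indexed), $w[i..j]$ is the substring from position $i$ to $j$, with $w[i..j]$ the empty string if $i > j$. A subsequence of $A$ is a string obtained from $A$ by deleting zero or more characters. $ZA[i]$ denotes the concatenation of $Z$ with the character $A[i]$. -}

module Defs where

open import Data.Nat using (ℕ; zero; suc; _+_; _≤_; _<_)
open import Data.Fin using (Fin; toℕ)
open import Data.List using (List; []; _∷_; _++_; [_]; length; take; lookup)
open import Data.List.Relation.Binary.Sublist.Propositional using (_⊆_)
open import Data.Product using (Σ; ∃; ∃₂; _×_; _,_)
open import Data.Sum using (_⊎_)
open import Relation.Nullary using (¬_)
open import Relation.Binary.PropositionalEquality using (_≡_)

-- Strings over an alphabet Σ are lists; subsequence = sublist (_⊆_).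

IsSuffix : {Σ : Set} → List Σ → List Σ → Set
IsSuffix u S = ∃ λ w → S ≡ w ++ u

IsSubstring : {Σ : Set} → List Σ → List Σ → Set
IsSubstring P Z = ∃₂ λ u v → Z ≡ u ++ P ++ v

Overlap : {Σ : Set} → List Σ → List Σ → ℕ → Set
Overlap P S k =
  k ≤ length P × IsSuffix (take k P) S ×
  (∀ k′ → k < k′ → k′ ≤ length P → ¬ IsSuffix (take k′ P) S)

Property : {Σ : Set} → List Σ → List Σ → ℕ → ℕ → ℕ → List Σ → Set
Property A P i s k Z =
  Z ⊆ take i A × ¬ IsSubstring P Z × length Z ≡ s × Overlap P Z k

LeastOrSucN : ℕ → ℕ → (ℕ → Set) → ℕ → Set
LeastOrSucN lo n Q e =
  (lo ≤ e × e ≤ n × Q e × (∀ e′ → lo ≤ e′ → e′ < e → ¬ Q e′))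
  ⊎ (e ≡ suc n × (∀ e′ → lo ≤ e′ → e′ ≤ n → ¬ Q e′))

DCand : {Σ : Set} → List Σ → List Σ → List Σ → ℕ → ℕ → ℕ → ℕ → Set
DCand A B P i s k e = ∃ λ Z → Z ⊆ take e B × Property A P i s k Z

IsD : {Σ : Set} → List Σ → List Σ → List Σ → ℕ → ℕ → ℕ → ℕ → Set
IsD A B P i s k e = LeastOrSucN 0 (length B) (DCand A B P i s k) e

-- condition on j defining j_t, for the position i (A[i] = lookup A i, 1-indexed i = toℕ i + 1):
-- A[i] = B[j] (1 ≤ j ≤ n) and some Z satisfies Property(i-1,s-1,t) with overlap(Z A[i]) = k
JCand : {Σ : Set} (A B P : List Σ) → Fin (length A) → ℕ → ℕ → ℕ → ℕ → Set
JCand A B P i s t k j =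
  (Σ (Fin (length B)) λ j′ → suc (toℕ j′) ≡ j × lookup A i ≡ lookup B j′)
  × (∃ λ Z → Property A P (toℕ i) s t Z × Overlap P (Z ++ [ lookup A i ]) k)

-- j_t = jt, given dprev = d(i-1,s-1,t); here s is s-1
IsJ : {Σ : Set} (A B P : List Σ) → Fin (length A) → ℕ → ℕ → ℕ → ℕ → ℕ → Set
IsJ A B P i s t k dprev jt = LeastOrSucN (suc dprev) (length B) (JCand A B P i s t k) jt

-- An optimal Z either avoids A[i], and is already counted by d(i-1,s,k), or ends with A[i]
-- matched at some B[j]. In the second case Z = Z′A[i], and overlap(Z′A[i]) depends only on
-- overlap(Z′) and A[i]: every prefix of P that is a suffix of Z′ is a suffix of the prefix of
-- length overlap(Z′). So Z′ can be exchanged for any string with the same overlap, which turns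
-- the minimum over Z into the minimum over t = overlap(Z′) of j_t. Since equality of Σ is not
-- assumed decidable, overlap(Z′) exists only under double negation; this suffices because the
-- final inequality between naturals is decidable.
module Submission where

open import Defs
open import Data.Nat using (ℕ; zero; suc; _≤_; _<_; _⊓_; z≤n; s≤s; _≤?_)
open import Data.Nat.Properties
open import Data.Fin using (Fin; toℕ; fromℕ<) renaming (zero to fzero; suc to fsuc)
open import Data.Fin.Properties using (toℕ<n; toℕ-fromℕ<)
open import Data.List using (List; []; _∷_; _++_; [_]; _∷ʳ_; length; foldr; tabulate; take; lookup; initLast; _∷ʳ′_)
open import Data.List.Properties using (take-suc; take-all; length-++; ++-assoc; ++-identityʳ; ∷-injective; ∷ʳ-injective; ∷ʳ-injectiveˡ; length-++-≤ʳ)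
open import Data.List.Membership.Propositional using (_∈_)
open import Data.List.Membership.Propositional.Properties using (∈-tabulate⁺)
open import Data.List.Relation.Unary.Any using (here; there)
open import Data.List.Relation.Unary.All using (All; []; _∷_)
open import Data.List.Relation.Unary.All.Properties using (tabulate⁺)
open import Data.List.Relation.Binary.Sublist.Propositional using (_⊆_; []; _∷_; ⊆-refl; ⊆-trans)
import Data.List.Relation.Binary.Sublist.Propositional as Sublist
open import Data.List.Relation.Binary.Sublist.Propositional.Properties using (++⁺; take⁺)
open import Data.List.Relation.Binary.Sublist.Heterogeneous.Properties using (length-mono-≤)
open import Data.Product using (Σ; ∃; _×_; _,_; proj₁; proj₂)
open import Data.Sum using (_⊎_; inj₁; inj₂)
open import Data.Empty using (⊥-elim)
open import Relation.Nullary using (¬_; yes; no; contradiction)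
open import Relation.Nullary.Decidable using (decidable-stable; ¬¬-excluded-middle)
open import Relation.Nullary.Negation using (¬¬-map)
open import Function using (_∘_)
open import Relation.Binary.PropositionalEquality using (_≡_; refl; sym; trans; cong; subst)

IsGreatest≤ : (ℕ → Set) → ℕ → ℕ → Set
IsGreatest≤ Q r k = k ≤ r × Q k × (∀ k′ → k < k′ → k′ ≤ r → ¬ Q k′)

¬¬-greatest : (Q : ℕ → Set) → Q 0 → ∀ r → ¬ ¬ ∃ (IsGreatest≤ Q r)
¬¬-greatest Q q₀ zero none = none (0 , z≤n , q₀ , λ _ 0<k′ k′≤0 _ → <⇒≱ 0<k′ k′≤0)
¬¬-greatest Q q₀ (suc r) none = ¬¬-excluded-middle λ where
    (yes q) → none (suc r , ≤-refl , q , λ _ r<k′ k′≤r _ → <⇒≱ r<k′ k′≤r)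
    (no ¬q) → ¬¬-greatest Q q₀ r (λ g → none (widen ¬q g))
  where
  widen : ¬ Q (suc r) → ∃ (IsGreatest≤ Q r) → ∃ (IsGreatest≤ Q (suc r))
  widen ¬q (k , k≤r , qk , above) = k , m≤n⇒m≤1+n k≤r , qk , above′
    where
    above′ : ∀ k′ → k < k′ → k′ ≤ suc r → ¬ Q k′
    above′ k′ k<k′ k′≤1+r with m≤n⇒m<n∨m≡n k′≤1+r
    ... | inj₁ k′<1+r = above k′ k<k′ (≤-pred k′<1+r)
    ... | inj₂ refl = ¬q

module _ {A : Set} where

  overlap-exists : (P S : List A) → ¬ ¬ ∃ (Overlap P S)
  overlap-exists P S = ¬¬-greatest (λ k → IsSuffix (take k P) S) (S , sym (++-identityʳ S)) (length P)

  IsSuffix-trans : {u v w : List A} → IsSuffix u v → IsSuffix v w → IsSuffix u w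
  IsSuffix-trans {u} (x , refl) (y , refl) = y ++ x , sym (++-assoc y x u)

  ++-suffix-by-length : (w w′ u v : List A) → w ++ u ≡ w′ ++ v → length u ≤ length v → IsSuffix u v
  ++-suffix-by-length w [] u v eq _ = w , sym eq
  ++-suffix-by-length [] (x ∷ w′) u v refl u≤v = ⊥-elim (<⇒≱ (s≤s (length-++-≤ʳ v {w′})) u≤v)
  ++-suffix-by-length (y ∷ w) (x ∷ w′) u v eq u≤v with ∷-injective eq
  ... | refl , eq′ = ++-suffix-by-length w w′ u v eq′ u≤v

  ∷ʳ-suffix⁺ : {xs ys : List A} {a : A} → IsSuffix xs ys → IsSuffix (xs ∷ʳ a) (ys ∷ʳ a)
  ∷ʳ-suffix⁺ {xs} {a = a} (w , refl) = w , ++-assoc w xs [ a ]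

  ∷ʳ-suffix⁻ : {xs ys : List A} {a b : A} → IsSuffix (xs ∷ʳ a) (ys ∷ʳ b) → IsSuffix xs ys × a ≡ b
  ∷ʳ-suffix⁻ {xs} {ys} {a} (w , eq) with ∷ʳ-injective ys (w ++ xs) (trans eq (sym (++-assoc w xs [ a ])))
  ... | ys≡ , b≡a = (w , ys≡) , sym b≡a

  take-suc-∷ʳ : (P : List A) (k : ℕ) → k < length P → ∃ λ a → take (suc k) P ≡ take k P ∷ʳ a
  take-suc-∷ʳ (x ∷ P) zero _ = x , refl
  take-suc-∷ʳ (x ∷ P) (suc k) (s≤s k<r) with take-suc-∷ʳ P k k<r
  ... | a , eq = a , cong (x ∷_) eq

  suffix⇒suffix-of-overlap : {P Z : List A} {t k : ℕ} → Overlap P Z t → k ≤ length P →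
                             IsSuffix (take k P) Z → IsSuffix (take k P) (take t P)
  suffix⇒suffix-of-overlap {P} {t = t} {k} (_ , (w , Z≡) , above) k≤r (w′ , Z≡′) =
    ++-suffix-by-length w′ w (take k P) (take t P) (trans (sym Z≡′) Z≡)
      (length-mono-≤ (take⁺ {xs = P} k≤t))
    where
    k≤t : k ≤ t
    k≤t = ≮⇒≥ (λ t<k → above k t<k k≤r (w′ , Z≡′))

  suffix-∷ʳ-transfer : {P Z Z′ : List A} {c : A} {t k : ℕ} → Overlap P Z t → Overlap P Z′ t →
                       k ≤ length P → IsSuffix (take k P) (Z ∷ʳ c) → IsSuffix (take k P) (Z′ ∷ʳ c)
  suffix-∷ʳ-transfer {Z′ = Z′} {c} {k = zero} _ _ _ _ = Z′ ∷ʳ c , sym (++-identityʳ _)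
  suffix-∷ʳ-transfer {P} {Z} {Z′} {c} {k = suc k} ovZ ovZ′ k<r suf with take-suc-∷ʳ P k k<r
  ... | a , eq with ∷ʳ-suffix⁻ (subst (λ p → IsSuffix p (Z ∷ʳ c)) eq suf)
  ... | suf′ , refl =
    subst (λ p → IsSuffix p (Z′ ∷ʳ c)) (sym eq)
      (∷ʳ-suffix⁺ (IsSuffix-trans (suffix⇒suffix-of-overlap ovZ (<⇒≤ k<r) suf′)
                                  (proj₁ (proj₂ ovZ′))))

  overlap-∷ʳ-transfer : {P Z Z′ : List A} {c : A} {t k : ℕ} → Overlap P Z t → Overlap P Z′ t →
                        Overlap P (Z ∷ʳ c) k → Overlap P (Z′ ∷ʳ c) k
  overlap-∷ʳ-transfer ovZ ovZ′ (k≤r , suf , above) =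
    k≤r , suffix-∷ʳ-transfer ovZ ovZ′ k≤r suf ,
    λ k′ k<k′ k′≤r suf′ → above k′ k<k′ k′≤r (suffix-∷ʳ-transfer ovZ′ ovZ k′≤r suf′)

  suffix⇒substring : {P Z : List A} → IsSuffix P Z → IsSubstring P Z
  suffix⇒substring {P} (w , eq) = w , [] , trans eq (cong (w ++_) (sym (++-identityʳ P)))

  substring-++ʳ : {P Z : List A} (w : List A) → IsSubstring P Z → IsSubstring P (Z ++ w)
  substring-++ʳ {P} w (u , v , refl) =
    u , v ++ w , trans (++-assoc u (P ++ v) w) (cong (u ++_) (++-assoc P v w))

  take-length : (P : List A) → take (length P) P ≡ P
  take-length P = take-all (length P) P ≤-refl

  overlap<length : {P Z : List A} {t : ℕ} → ¬ IsSubstring P Z → Overlap P Z t → t < length P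
  overlap<length {P} {Z} noP (t≤r , suf , _) = ≤∧≢⇒< t≤r λ where
    refl → noP (suffix⇒substring (subst (λ p → IsSuffix p Z) (take-length P) suf))

  ¬substring-∷ʳ : {P Z : List A} {c : A} {k : ℕ} → ¬ IsSubstring P Z → Overlap P (Z ∷ʳ c) k →
                  k < length P → ¬ IsSubstring P (Z ∷ʳ c)
  ¬substring-∷ʳ {P} {Z} {c} noP (_ , _ , above) k<r (u , v , eq) with initLast v
  ... | [] = above (length P) k<r ≤-refl
                (subst (λ p → IsSuffix p (Z ∷ʳ c)) (sym (take-length P))
                  (u , trans eq (cong (u ++_) (++-identityʳ P))))
  ... | v′ ∷ʳ′ x = noP (u , v′ , ∷ʳ-injectiveˡ Z (u ++ P ++ v′)
                (trans eq (sym (trans (++-assoc u (P ++ v′) [ x ]) (cong (u ++_) (++-assoc P v′ [ x ]))))))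

  length-∷ʳ : (xs : List A) {x : A} → length (xs ∷ʳ x) ≡ suc (length xs)
  length-∷ʳ xs = trans (length-++ xs) (+-comm (length xs) 1)

  ⊆-∷ʳ⁻ : (xs : List A) {a : A} {Z : List A} → Z ⊆ xs ∷ʳ a →
          Z ⊆ xs ⊎ ∃ λ Z′ → Z ≡ Z′ ∷ʳ a × Z′ ⊆ xs
  ⊆-∷ʳ⁻ [] (_ Sublist.∷ʳ []) = inj₁ []
  ⊆-∷ʳ⁻ [] (refl ∷ []) = inj₂ ([] , refl , [])
  ⊆-∷ʳ⁻ (x ∷ xs) (.x Sublist.∷ʳ p) with ⊆-∷ʳ⁻ xs p
  ... | inj₁ q = inj₁ (x Sublist.∷ʳ q)
  ... | inj₂ (Z′ , eq , q) = inj₂ (Z′ , eq , x Sublist.∷ʳ q)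
  ⊆-∷ʳ⁻ (x ∷ xs) (eq ∷ p) with ⊆-∷ʳ⁻ xs p
  ... | inj₁ q = inj₁ (eq ∷ q)
  ... | inj₂ (Z′ , refl , q) = inj₂ (_ ∷ Z′ , refl , eq ∷ q)

  ∷ʳ-⊈[] : {Z : List A} {c : A} → ¬ (Z ∷ʳ c ⊆ [])
  ∷ʳ-⊈[] {[]} ()
  ∷ʳ-⊈[] {_ ∷ _} ()

  ∷ʳ-⊆-take⁻ : (B : List A) (e : ℕ) {Z : List A} {c : A} → Z ∷ʳ c ⊆ take e B →
               Σ (Fin (length B)) λ j → suc (toℕ j) ≤ e × lookup B j ≡ c × Z ⊆ take (toℕ j) B
  ∷ʳ-⊆-take⁻ B zero p = ⊥-elim (∷ʳ-⊈[] p)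
  ∷ʳ-⊆-take⁻ [] (suc e) p = ⊥-elim (∷ʳ-⊈[] p)
  ∷ʳ-⊆-take⁻ (b ∷ B) (suc e) {[]} (refl ∷ _) = fzero , s≤s z≤n , refl , []
  ∷ʳ-⊆-take⁻ (b ∷ B) (suc e) {[]} (.b Sublist.∷ʳ p) with ∷ʳ-⊆-take⁻ B e p
  ... | j , j<e , Bj≡c , q = fsuc j , s≤s j<e , Bj≡c , b Sublist.∷ʳ q
  ∷ʳ-⊆-take⁻ (b ∷ B) (suc e) {_ ∷ _} (.b Sublist.∷ʳ p) with ∷ʳ-⊆-take⁻ B e p
  ... | j , j<e , Bj≡c , q = fsuc j , s≤s j<e , Bj≡c , b Sublist.∷ʳ q
  ∷ʳ-⊆-take⁻ (b ∷ B) (suc e) {_ ∷ _} (z≡b ∷ p) with ∷ʳ-⊆-take⁻ B e p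
  ... | j , j<e , Bj≡c , q = fsuc j , s≤s j<e , Bj≡c , z≡b ∷ q

foldr-⊓-≤-init : (a : ℕ) (xs : List ℕ) → foldr _⊓_ a xs ≤ a
foldr-⊓-≤-init a [] = ≤-refl
foldr-⊓-≤-init a (x ∷ xs) = ≤-trans (m⊓n≤n x _) (foldr-⊓-≤-init a xs)

foldr-⊓-≤-∈ : {a x : ℕ} {xs : List ℕ} → x ∈ xs → foldr _⊓_ a xs ≤ x
foldr-⊓-≤-∈ (here refl) = m⊓n≤m _ _
foldr-⊓-≤-∈ (there x∈xs) = ≤-trans (m⊓n≤n _ _) (foldr-⊓-≤-∈ x∈xs)

foldr-⊓-glb : {a y : ℕ} {xs : List ℕ} → y ≤ a → All (y ≤_) xs → y ≤ foldr _⊓_ a xs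
foldr-⊓-glb y≤a [] = y≤a
foldr-⊓-glb y≤a (y≤x ∷ y≤xs) = ⊓-glb y≤x (foldr-⊓-glb y≤a y≤xs)

least-≤ : {lo n e x : ℕ} {Q : ℕ → Set} → LeastOrSucN lo n Q e → lo ≤ x → x ≤ n → Q x → e ≤ x
least-≤ (inj₁ (_ , _ , _ , below)) lo≤x _ qx = ≮⇒≥ (λ x<e → below _ lo≤x x<e qx)
least-≤ (inj₂ (_ , none)) lo≤x x≤n qx = ⊥-elim (none _ lo≤x x≤n qx)

least-≤1+n : {lo n e : ℕ} {Q : ℕ → Set} → LeastOrSucN lo n Q e → e ≤ suc n
least-≤1+n (inj₁ (_ , e≤n , _)) = m≤n⇒m≤1+n e≤n
least-≤1+n (inj₂ (e≡1+n , _)) = ≤-reflexive e≡1+n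

least-witness : {lo n e : ℕ} {Q : ℕ → Set} → LeastOrSucN lo n Q e → e ≤ n → Q e
least-witness (inj₁ (_ , _ , qe , _)) _ = qe
least-witness (inj₂ (e≡1+n , _)) e≤n = ⊥-elim (1+n≰n (≤-trans (≤-reflexive (sym e≡1+n)) e≤n))

least-anti : {lo lo′ n e e′ : ℕ} {Q Q′ : ℕ → Set} →
             LeastOrSucN lo n Q e → LeastOrSucN lo′ n Q′ e′ →
             (∀ {x} → lo ≤ x → x ≤ n → Q x → lo′ ≤ x × Q′ x) → e′ ≤ e
least-anti (inj₁ (lo≤e , e≤n , qe , _)) least′ Q⇒Q′ with Q⇒Q′ lo≤e e≤n qe
... | lo′≤e , q′e = least-≤ least′ lo′≤e e≤n q′e
least-anti (inj₂ (e≡1+n , _)) least′ _ = ≤-trans (least-≤1+n least′) (≤-reflexive (sym e≡1+n))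

module _ {Σ : Set} (A B P : List Σ) where

  DCand-mono : {i i′ s k e : ℕ} → i ≤ i′ → DCand A B P i s k e → DCand A B P i′ s k e
  DCand-mono i≤i′ (Z , Z⊆B , Z⊆A , noP , len , ov) =
    Z , Z⊆B , ⊆-trans Z⊆A (take⁺ i≤i′) , noP , len , ov

  module _ (i : Fin (length A)) (s k : ℕ) where

    DCand-snoc : {t d j : ℕ} → k < length P →
                 DCand A B P (toℕ i) s t d → d < j → JCand A B P i s t k j →
                 DCand A B P (suc (toℕ i)) (suc s) k j
    DCand-snoc k<r (Z , Z⊆B , Z⊆A , noP , len , ovZ) d<j
               ((j′ , refl , Ai≡Bj) , (_ , (_ , _ , _ , ovZ₀) , ovZ₀c)) =
      Z ∷ʳ lookup A i , Zc⊆B , Zc⊆A ,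
      ¬substring-∷ʳ noP ovZc k<r , trans (length-∷ʳ Z) (cong suc len) , ovZc
      where
      ovZc : Overlap P (Z ∷ʳ lookup A i) k
      ovZc = overlap-∷ʳ-transfer ovZ₀ ovZ ovZ₀c
      Zc⊆B : Z ∷ʳ lookup A i ⊆ take (suc (toℕ j′)) B
      Zc⊆B rewrite take-suc B j′ | Ai≡Bj = ++⁺ (⊆-trans Z⊆B (take⁺ (≤-pred d<j))) ⊆-refl
      Zc⊆A : Z ∷ʳ lookup A i ⊆ take (suc (toℕ i)) A
      Zc⊆A rewrite take-suc A i = ++⁺ Z⊆A ⊆-refl

    LastMatchBefore : ℕ → Set
    LastMatchBefore e = ∃ λ (t : Fin (length P)) → ∃ λ (j : Fin (length B)) → suc (toℕ j) ≤ e ×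
      DCand A B P (toℕ i) s (toℕ t) (toℕ j) × JCand A B P i s (toℕ t) k (suc (toℕ j))

    DCand-cases : {e : ℕ} → DCand A B P (suc (toℕ i)) (suc s) k e →
                  DCand A B P (toℕ i) (suc s) k e ⊎ ¬ ¬ LastMatchBefore e
    DCand-cases {e} (Z , Z⊆B , Z⊆A , noP , len , ov)
      with ⊆-∷ʳ⁻ (take (toℕ i) A) (subst (Z ⊆_) (take-suc A i) Z⊆A)
    ... | inj₁ Z⊆A′ = inj₁ (Z , Z⊆B , Z⊆A′ , noP , len , ov)
    ... | inj₂ (Z′ , refl , Z′⊆A) = inj₂ (¬¬-map last-match (overlap-exists P Z′))
      where
      noP′ : ¬ IsSubstring P Z′
      noP′ = noP ∘ substring-++ʳ [ lookup A i ]
      last-match : ∃ (Overlap P Z′) → LastMatchBefore e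
      last-match (t , ovZ′) with ∷ʳ-⊆-take⁻ B e Z⊆B
      ... | j , j<e , Bj≡Ai , Z′⊆B =
        tF , j , j<e , (Z′ , Z′⊆B , prop) , (j , refl , sym Bj≡Ai) , Z′ , prop , ov
        where
        t<r : t < length P
        t<r = overlap<length noP′ ovZ′
        tF : Fin (length P)
        tF = fromℕ< t<r
        prop : Property A P (toℕ i) s (toℕ tF) Z′
        prop = Z′⊆A , noP′ , suc-injective (trans (sym (length-∷ʳ Z′)) len) ,
               subst (Overlap P Z′) (sym (toℕ-fromℕ< t<r)) ovZ′

lemma1 : {Σ : Set} (A B P : List Σ) → 1 ≤ length P →
         (i : Fin (length A)) (s k : ℕ) → k < length P →
         (e : ℕ) → IsD A B P (suc (toℕ i)) (suc s) k e →
         (e₁ : ℕ) → IsD A B P (toℕ i) (suc s) k e₁ →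
         (dprev : Fin (length P) → ℕ) →
         (∀ t → IsD A B P (toℕ i) s (toℕ t) (dprev t)) →
         (jt : Fin (length P) → ℕ) →
         (∀ t → IsJ A B P i s (toℕ t) k (dprev t) (jt t)) →
         e ≡ foldr _⊓_ e₁ (tabulate jt)
-- The hypothesis 1 ≤ length P is implied by k < length P.
lemma1 A B P _ i s k k<r e isE e₁ isE₁ dprev isD jt isJ =
  ≤-antisym e≤min (decidable-stable (_ ≤? e) (min≤e isE))
  where
  min : ℕ
  min = foldr _⊓_ e₁ (tabulate jt)

  min≤e₁ : min ≤ e₁
  min≤e₁ = foldr-⊓-≤-init e₁ (tabulate jt)

  e≤jt : ∀ t → e ≤ jt t
  e≤jt t = least-anti (isJ t) isE λ d<x x≤n jcand →
    z≤n , DCand-snoc A B P i s k k<r (least-witness (isD t) (<⇒≤ (<-≤-trans d<x x≤n))) d<x jcand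

  e≤min : e ≤ min
  e≤min = foldr-⊓-glb (least-anti isE₁ isE (λ _ _ dcand → z≤n , DCand-mono A B P (n≤1+n _) dcand))
                      (tabulate⁺ e≤jt)

  min≤jt≤e : LastMatchBefore A B P i s k e → min ≤ e
  min≤jt≤e (t , j , j<e , dcand , jcand) = begin
    min          ≤⟨ foldr-⊓-≤-∈ (∈-tabulate⁺ t) ⟩
    jt t         ≤⟨ least-≤ (isJ t) (s≤s dprev≤j) (toℕ<n j) jcand ⟩
    suc (toℕ j)  ≤⟨ j<e ⟩
    e            ∎
    where
    open ≤-Reasoning
    dprev≤j : dprev t ≤ toℕ j
    dprev≤j = least-≤ (isD t) z≤n (<⇒≤ (toℕ<n j)) dcand

  min≤e : IsD A B P (suc (toℕ i)) (suc s) k e → ¬ ¬ (min ≤ e)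
  min≤e (inj₂ (e≡1+n , _)) =
    contradiction (≤-trans min≤e₁ (≤-trans (least-≤1+n isE₁) (≤-reflexive (sym e≡1+n))))
  min≤e (inj₁ (_ , e≤n , dcand , _)) with DCand-cases A B P i s k dcand
  ... | inj₁ dcand′ = contradiction (≤-trans min≤e₁ (least-≤ isE₁ z≤n e≤n dcand′))
  ... | inj₂ match = ¬¬-map min≤jt≤e match
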